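{- For all integers $s \ge 1$ and $t \ge 1$, $|NE_{s,t}(312)| = 1$.
   Context: For positive integers $s,t$, write each $x \in [st]=\{1,\dots,st\}$ uniquely as $x=(j-1)t+r$ with $1\le j\le s$ and $1\le r\le t$. The poset $NE_{s,t}$ is $[st]$ with the partial order $(j-1)t+r \preceq (j'-1)t+r'$ if and only if $j'\le j$ and $r'\le r$. A linear extension of a poset $([n],\preceq)$ is a permutation $\pi=\pi(1)\cdots\pi(n)$ of $[n]$ (one-line notation) such that whenever $a\preceq b$ and $a\ne b$, $a$ appears before $b$ in $\pi$. A permutation $\pi$ contains $\sigma$ if $\pi$ has a subsequence with the same relative order as $\sigma$, and avoids $\sigma$ otherwise. $P(\sigma)$ denotes the set of linear extensions of the poset $P$ avoiding $\sigma$. -}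

module Defs where

open import Data.Nat using (ℕ; zero; suc; _+_; _*_; _∸_; _≤_; _<_)
open import Data.List using (List; []; _∷_; _++_; map; upTo)
open import Data.Product using (Σ; ∃; _×_; _,_)
open import Relation.Binary.PropositionalEquality using (_≡_; _≢_)
open import Relation.Nullary using (¬_)
open import Data.List.Relation.Binary.Permutation.Propositional using (_↭_)

[_] : ℕ → List ℕ
[ n ] = map suc (upTo n)

Coord : (s t x j r : ℕ) → Set
Coord s t x j r = (1 ≤ j) × (j ≤ s) × (1 ≤ r) × (r ≤ t) × (x ≡ (j ∸ 1) * t + r)

NE≼ : (s t : ℕ) → ℕ → ℕ → Set
NE≼ s t x y = Σ ℕ λ j → Σ ℕ λ r → Σ ℕ λ j' → Σ ℕ λ r' →
  Coord s t x j r × Coord s t y j' r' × j' ≤ j × r' ≤ r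

Before : List ℕ → ℕ → ℕ → Set
Before π a b = Σ (List ℕ) λ xs → Σ (List ℕ) λ ys → Σ (List ℕ) λ zs →
  π ≡ xs ++ (a ∷ ys) ++ (b ∷ zs)

LinearExtension : (n : ℕ) → (ℕ → ℕ → Set) → List ℕ → Set
LinearExtension n _≼_ π =
  (π ↭ [ n ]) × (∀ a b → a ≼ b → a ≢ b → Before π a b)

Contains312 : List ℕ → Set
Contains312 π = Σ ℕ λ a → Σ ℕ λ b → Σ ℕ λ c →
  Σ (List ℕ) λ xs → Σ (List ℕ) λ ys → Σ (List ℕ) λ zs → Σ (List ℕ) λ ws →
  (π ≡ xs ++ (c ∷ ys) ++ (a ∷ zs) ++ (b ∷ ws)) × a < b × b < c

Avoids312 : List ℕ → Set
Avoids312 π = ¬ Contains312 π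

NE312 : (s t : ℕ) → List ℕ → Set
NE312 s t π = LinearExtension (s * t) (NE≼ s t) π × Avoids312 π

-- Since x ⪯ y forces y ≤ x numerically, the decreasing permutation st ⋯ 2 1 is a
-- linear extension of NE_{s,t}, and a decreasing permutation avoids 312.
-- Conversely st = (s-1)t + t is the least element of NE_{s,t}, so every linear
-- extension starts with st; if it also avoids 312 it is decreasing, because an
-- ascent a < b later on would form the pattern st a b. Decreasing permutations of
-- [st] are unique.
module Submission where

open import Defs
open import Relation.Binary.PropositionalEquality hiding ([_])
open import Data.Nat using (ℕ; zero; suc; _+_; _*_; _∸_; _≤_; _<_; _>_; z≤n; s≤s; _≟_)
open import Data.Nat.Properties
open import Data.Nat.DivMod using (_/_; _%_; m≡m%n+[m/n]*n; m%n<n; m<n*o⇒m/o<n)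
open import Data.List using (List; []; _∷_; _++_; map; upTo; downFrom)
open import Data.List.Properties using (++-assoc; reverse-upTo)
open import Data.List.Membership.Propositional using (_∈_)
open import Data.List.Membership.Propositional.Properties
  using (∈-∃++; ∈-++⁺ʳ; ∈-map⁺; ∈-map⁻; ∈-upTo⁺; ∈-upTo⁻)
open import Data.List.Relation.Unary.Any using (here; there)
open import Data.List.Relation.Unary.All as All using (All; _∷_)
open import Data.List.Relation.Unary.AllPairs as AllPairs using (AllPairs; []; _∷_)
import Data.List.Relation.Unary.AllPairs.Properties as AllPairs
open import Data.List.Relation.Unary.Unique.Propositional using (Unique)
import Data.List.Relation.Unary.Unique.Propositional.Properties as Unique
open import Data.List.Relation.Unary.Sorted.TotalOrder using (Sorted)
open import Data.List.Relation.Unary.Sorted.TotalOrder.Properties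
  using (AllPairs⇒Sorted; ↗↭↗⇒≋)
open import Data.List.Relation.Binary.Equality.Propositional using (≋⇒≡)
open import Data.List.Relation.Binary.Permutation.Propositional using (_↭_; ↭-sym; ↭-trans; ↭⇒↭ₛ)
open import Data.List.Relation.Binary.Permutation.Propositional.Properties
  using (∈-resp-↭; ↭-reverse)
import Data.List.Relation.Binary.Permutation.Propositional.Properties as Perm
open import Data.List.Relation.Binary.Permutation.Setoid.Properties (setoid ℕ)
  using (Unique-resp-↭)
open import Data.Product using (Σ; ∃₂; _×_; _,_; proj₁; proj₂)
open import Data.Empty using (⊥-elim)
open import Function using (_∘′_)
open import Relation.Binary.Bundles using (TotalOrder)
import Relation.Binary.Construct.Flip.EqAndOrd as Flip
open import Relation.Nullary using (¬_; yes; no)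

Descending : List ℕ → Set
Descending = AllPairs _>_

≥-totalOrder : TotalOrder _ _ _
≥-totalOrder = Flip.totalOrder ≤-totalOrder

descending-↭⇒≡ : ∀ {xs ys} → Descending xs → Descending ys → xs ↭ ys → xs ≡ ys
descending-↭⇒≡ xs↘ ys↘ xs↭ys =
  ≋⇒≡ (↗↭↗⇒≋ ≥-totalOrder (sorted xs↘) (sorted ys↘) (↭⇒↭ₛ xs↭ys))
  where
  sorted : ∀ {zs} → Descending zs → Sorted ≥-totalOrder zs
  sorted zs↘ = AllPairs⇒Sorted ≥-totalOrder (AllPairs.map <⇒≤ zs↘)

∷-before : ∀ {l a b} x → Before l a b → Before (x ∷ l) a b
∷-before x (xs , ys , zs , refl) = x ∷ xs , ys , zs , refl

before-∈ʳ : ∀ {l a b} → Before l a b → b ∈ l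
before-∈ʳ (xs , ys , zs , refl) = ∈-++⁺ʳ xs (there (∈-++⁺ʳ ys (here refl)))

allPairs-before : ∀ {R : ℕ → ℕ → Set} {l a b} → AllPairs R l → Before l a b → R a b
allPairs-before (Ra ∷ _) ([] , ys , zs , refl) = All.lookup Ra (∈-++⁺ʳ ys (here refl))
allPairs-before (_ ∷ Rl) (x ∷ xs , ys , zs , refl) = allPairs-before Rl (xs , ys , zs , refl)

before-allPairs : ∀ {R : ℕ → ℕ → Set} l → (∀ {a b} → Before l a b → R a b) → AllPairs R l
before-allPairs [] _ = []
before-allPairs (x ∷ l) R-before =
  All.tabulate (λ b∈l → let ys , zs , l≡ = ∈-∃++ b∈l in
                        R-before ([] , ys , zs , cong (x ∷_) l≡))
  ∷ before-allPairs l (R-before ∘′ ∷-before x)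

unique⇒¬before-head : ∀ {h l a} → Unique (h ∷ l) → ¬ Before (h ∷ l) a h
unique⇒¬before-head (h∉l ∷ _) ([] , ys , zs , refl) = All.lookup h∉l (∈-++⁺ʳ ys (here refl)) refl
unique⇒¬before-head (h∉l ∷ _) (_ ∷ xs , ys , zs , refl) =
  All.lookup h∉l (before-∈ʳ (xs , ys , zs , refl)) refl

descending-before : ∀ {l a b} → Descending l → a ∈ l → b ∈ l → b < a → Before l a b
descending-before _ (here refl) (here refl) b<a = ⊥-elim (<-irrefl refl b<a)
descending-before _ (here refl) (there b∈l) _ =
  let ys , zs , l≡ = ∈-∃++ b∈l in [] , ys , zs , cong (_ ∷_) l≡
descending-before (x>l ∷ _) (there a∈l) (here refl) b<a = ⊥-elim (<-asym b<a (All.lookup x>l a∈l))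
descending-before (_ ∷ l↘) (there a∈l) (there b∈l) b<a =
  ∷-before _ (descending-before l↘ a∈l b∈l b<a)

descending⇒avoids312 : ∀ {l} → Descending l → Avoids312 l
descending⇒avoids312 l↘ (a , b , c , xs , ys , zs , ws , refl , a<b , _) =
  <-asym a<b (allPairs-before l↘ (xs ++ c ∷ ys , zs , ws , sym (++-assoc xs (c ∷ ys) _)))

avoids312⇒descending : ∀ {m l} → All (_≤ m) l → Unique (m ∷ l) → Avoids312 (m ∷ l) →
  Descending (m ∷ l)
avoids312⇒descending {m} {l} l≤m (m∉l ∷ l-unique) avoids = l<m ∷ before-allPairs l b<a
  where
  l<m : All (_< m) l
  l<m = All.zipWith (λ (x≤m , m≢x) → ≤∧≢⇒< x≤m (≢-sym m≢x)) (l≤m , m∉l)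
  b<a : ∀ {a b} → Before l a b → b < a
  b<a {a} {b} a-before-b@(ys , zs , ws , l≡) =
    ≤∧≢⇒< (≮⇒≥ no-ascent) (≢-sym (allPairs-before l-unique a-before-b))
    where
    no-ascent : ¬ a < b
    no-ascent a<b = avoids (a , b , m , [] , ys , zs , ws , cong (m ∷_) l≡ , a<b ,
                            All.lookup l<m (before-∈ʳ a-before-b))

∈-[]⁺ : ∀ {n x} → 1 ≤ x → x ≤ n → x ∈ [ n ]
∈-[]⁺ {x = suc y} _ y<n = ∈-map⁺ suc (∈-upTo⁺ y<n)

∈-[]⁻ : ∀ {n x} → x ∈ [ n ] → 1 ≤ x × x ≤ n
∈-[]⁻ x∈[n] with _ , y∈upTo , refl ← ∈-map⁻ suc x∈[n] = s≤s z≤n , ∈-upTo⁻ y∈upTo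

[]-unique : ∀ n → Unique [ n ]
[]-unique n = Unique.map⁺ suc-injective (Unique.upTo⁺ n)

countdown : ℕ → List ℕ
countdown n = map suc (downFrom n)

countdown-descending : ∀ n → Descending (countdown n)
countdown-descending n = AllPairs.map⁺ (AllPairs.applyDownFrom⁺₁ _ n (λ j<i _ → s≤s j<i))

[]↭countdown : ∀ n → [ n ] ↭ countdown n
[]↭countdown n = Perm.map⁺ suc (subst (upTo n ↭_) (reverse-upTo n) (↭-sym (↭-reverse (upTo n))))

coord-positive : ∀ {s t x j r} → Coord s t x j r → 1 ≤ x
coord-positive {r = r} (_ , _ , 1≤r , _ , refl) = ≤-trans 1≤r (m≤n+m r _)

coord-≤ : ∀ {s t x j r} → Coord s t x j r → x ≤ s * t
coord-≤ {zero} (1≤j , j≤0 , _) = ⊥-elim (<⇒≱ 1≤j j≤0)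
coord-≤ {suc s} {t} {j = j} {r} (_ , j≤1+s , _ , r≤t , refl) = begin
  (j ∸ 1) * t + r ≤⟨ +-mono-≤ (*-monoˡ-≤ t (∸-monoˡ-≤ 1 j≤1+s)) r≤t ⟩
  s * t + t       ≡⟨ +-comm (s * t) t ⟩
  suc s * t       ∎
  where open ≤-Reasoning

coord-exists : ∀ {s t x} → 1 ≤ x → x ≤ s * t → ∃₂ (Coord s t x)
coord-exists {s} {zero} {x} 1≤x x≤0 = ⊥-elim (<⇒≱ 1≤x (subst (x ≤_) (*-zeroʳ s) x≤0))
coord-exists {s} {t@(suc _)} {suc y} _ y<st =
  suc (y / t) , suc (y % t) , s≤s z≤n , m<n*o⇒m/o<n y<st , s≤s z≤n , m%n<n y t , 1+y≡
  where
  open ≡-Reasoning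
  1+y≡ : suc y ≡ y / t * t + suc (y % t)
  1+y≡ = begin
    suc y                   ≡⟨ cong suc (m≡m%n+[m/n]*n y t) ⟩
    suc (y % t + y / t * t) ≡⟨ cong suc (+-comm (y % t) _) ⟩
    suc (y / t * t + y % t) ≡⟨ +-suc (y / t * t) (y % t) ⟨
    y / t * t + suc (y % t) ∎

coord-top : ∀ {s t} → 1 ≤ s → 1 ≤ t → Coord s t (s * t) s t
coord-top {suc s} {t} _ 1≤t = s≤s z≤n , ≤-refl , 1≤t , ≤-refl , +-comm t (s * t)

NE≼⇒≥ : ∀ {s t x y} → NE≼ s t x y → y ≤ x
NE≼⇒≥ {t = t} (_ , _ , _ , _ , (_ , _ , _ , _ , refl) , (_ , _ , _ , _ , refl) , j'≤j , r'≤r) =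
  +-mono-≤ (*-monoˡ-≤ t (∸-monoˡ-≤ 1 j'≤j)) r'≤r

NE≼-top : ∀ {s t x} → 1 ≤ s → 1 ≤ t → 1 ≤ x → x ≤ s * t → NE≼ s t (s * t) x
NE≼-top {s} {t} 1≤s 1≤t 1≤x x≤st =
  let j , r , x-coord@(_ , j≤s , _ , r≤t , _) = coord-exists 1≤x x≤st
  in s , t , j , r , coord-top 1≤s 1≤t , x-coord , j≤s , r≤t

linearExtension-starts-with-least : ∀ {_≼_ : ℕ → ℕ → Set} {h l m} → Unique (h ∷ l) →
  (∀ a b → a ≼ b → a ≢ b → Before (h ∷ l) a b) → m ≼ h → m ≡ h
linearExtension-starts-with-least {h = h} {m = m} unique extends m≼h with m ≟ h
... | yes m≡h = m≡h
... | no m≢h = ⊥-elim (unique⇒¬before-head unique (extends _ _ m≼h m≢h))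

countdown-linearExtension : ∀ s t → LinearExtension (s * t) (NE≼ s t) (countdown (s * t))
countdown-linearExtension s t = ↭-sym ([]↭countdown n) , extends
  where
  n = s * t
  ∈-countdown : ∀ {x j r} → Coord s t x j r → x ∈ countdown n
  ∈-countdown x-coord =
    ∈-resp-↭ ([]↭countdown n) (∈-[]⁺ (coord-positive x-coord) (coord-≤ x-coord))
  extends : ∀ a b → NE≼ s t a b → a ≢ b → Before (countdown n) a b
  extends a b a≼b@(_ , _ , _ , _ , a-coord , b-coord , _) a≢b =
    descending-before (countdown-descending n) (∈-countdown a-coord) (∈-countdown b-coord)
      (≤∧≢⇒< (NE≼⇒≥ a≼b) (≢-sym a≢b))

NE312⇒descending : ∀ {s t π} → 1 ≤ s → 1 ≤ t → NE312 s t π → Descending π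
NE312⇒descending {s} {t} {[]} 1≤s 1≤t ((π↭[n] , _) , _)
  with () ← ∈-resp-↭ (↭-sym π↭[n]) (∈-[]⁺ (*-mono-≤ 1≤s 1≤t) ≤-refl)
NE312⇒descending {s} {t} {h ∷ l} 1≤s 1≤t ((π↭[n] , extends) , avoids) =
  top-first (linearExtension-starts-with-least π-unique extends
              (NE≼-top 1≤s 1≤t (proj₁ (∈-π (here refl))) (proj₂ (∈-π (here refl)))))
  where
  π-unique : Unique (h ∷ l)
  π-unique = Unique-resp-↭ (↭⇒↭ₛ (↭-sym π↭[n])) ([]-unique (s * t))
  ∈-π : ∀ {x} → x ∈ h ∷ l → 1 ≤ x × x ≤ s * t
  ∈-π x∈π = ∈-[]⁻ (∈-resp-↭ π↭[n] x∈π)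
  top-first : s * t ≡ h → Descending (h ∷ l)
  top-first refl =
    avoids312⇒descending (All.tabulate (λ x∈l → proj₂ (∈-π (there x∈l)))) π-unique avoids

theorem3p9 : (s t : ℕ) → 1 ≤ s → 1 ≤ t →
    Σ (List ℕ) λ π → NE312 s t π × ((π' : List ℕ) → NE312 s t π' → π' ≡ π)
theorem3p9 s t 1≤s 1≤t =
  countdown n ,
  (countdown-linearExtension s t , descending⇒avoids312 (countdown-descending n)) ,
  λ π π∈NE312@((π↭[n] , _) , _) →
    descending-↭⇒≡ (NE312⇒descending 1≤s 1≤t π∈NE312) (countdown-descending n)
      (↭-trans π↭[n] ([]↭countdown n))
  where
  n = s * t
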